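{- If $G$ is a connected graph that has a $k$-core, then $\mathrm{cat}(G)\geq k$.
   Context: Cat Herding is a two-player game on a finite simple graph $G$ between a cat and a herder. First the cat places its token on a starting vertex. Then the players alternate, the herder moving first: on the herder's turn it deletes one edge of the current graph (a "cut"); on the cat's turn the cat must move its token along a path of the current graph to a different vertex. The game ends when the cat's current vertex has no incident edges. The score is the total number of edges deleted; the herder minimizes and the cat maximizes it. For $v\in V(G)$, $\mathrm{cat}(G,v)$ is the optimal-play score when the cat starts at $v$, and $\mathrm{cat}(G)=\max_{v\in V(G)}\mathrm{cat}(G,v)$. A $k$-core of $G$ is a (nonempty) maximal subgraph $H$ of $G$ in which every vertex has degree at least $k$ in $H$. -}

module Defs where

open import Data.Nat using (ℕ; zero; suc; _≤_; _<_; _⊓_; _⊔_)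
open import Data.Fin using (Fin; toℕ; _≟_)
open import Data.Bool using (Bool; true; false; _∧_; _∨_; not; if_then_else_; T)
open import Data.List using (List; []; _∷_; map; length; lookup; allFin; filterᵇ)
open import Data.Bool.ListAction using (any)
open import Data.Product using (_×_; _,_; proj₁; proj₂; Σ; ∃)
open import Data.List.Relation.Unary.All using (All)
open import Data.List.Relation.Unary.Unique.Propositional using (Unique)
open import Relation.Nullary.Decidable using (⌊_⌋)

Edge : ℕ → Set
Edge n = Fin n × Fin n

-- A finite simple graph on vertex set Fin n: a duplicate-free list of edges,
-- each stored with strictly smaller endpoint first (so no loops, no multi-edges).
record Graph (n : ℕ) : Set where
  field
    edges   : List (Edge n)
    ordered : All (λ e → toℕ (proj₁ e) < toℕ (proj₂ e)) edges
    unique  : Unique edges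
open Graph public

module _ {n : ℕ} where

  incident : Fin n → Edge n → Bool
  incident v (a , b) = ⌊ v ≟ a ⌋ ∨ ⌊ v ≟ b ⌋

  isolated : List (Edge n) → Fin n → Bool
  isolated E v = not (any (incident v) E)

  reach : ℕ → List (Edge n) → Fin n → Fin n → Bool
  reach zero    E u w = ⌊ u ≟ w ⌋
  reach (suc k) E u w =
    reach k E u w ∨
    any (λ e → (⌊ proj₂ e ≟ w ⌋ ∧ reach k E u (proj₁ e)) ∨ (⌊ proj₁ e ≟ w ⌋ ∧ reach k E u (proj₂ e))) E

  -- all edge sets obtained by deleting exactly one edge of E (the herder's possible cuts)
  removals : List (Edge n) → List (List (Edge n))
  removals []       = []
  removals (e ∷ es) = es ∷ map (e ∷_) (removals es)

  catMoves : List (Edge n) → Fin n → List (Fin n)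
  catMoves E v = filterᵇ (λ w → not ⌊ w ≟ v ⌋ ∧ reach n E v w) (allFin n)

-- minimum of a list (only used on nonempty lists), maximum of a list (0 for empty)
minL : List ℕ → ℕ
minL []           = 0
minL (x ∷ [])     = x
minL (x ∷ y ∷ xs) = x ⊓ minL (y ∷ xs)

maxL : List ℕ → ℕ
maxL []       = 0
maxL (x ∷ xs) = x ⊔ maxL xs

-- Optimal-play remaining score, herder to move, current edge set E, cat at v.
-- The fuel f is always instantiated with length E (each cut removes exactly one edge),
-- so it never runs out before the game ends.
mutual
  herderVal : {n : ℕ} → ℕ → List (Edge n) → Fin n → ℕ
  herderVal zero    E v = 0
  herderVal (suc f) E v =
    if isolated E v then 0
    else minL (map (λ E' → suc (catVal f E' v)) (removals E))

  catVal : {n : ℕ} → ℕ → List (Edge n) → Fin n → ℕ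
  catVal f E v =
    if isolated E v then 0
    else maxL (map (herderVal f E) (catMoves E v))

catFrom : {n : ℕ} → Graph n → Fin n → ℕ
catFrom G v = herderVal (length (edges G)) (edges G) v

cat : {n : ℕ} → Graph n → ℕ
cat {n} G = maxL (map (catFrom G) (allFin n))

Connected : {n : ℕ} → Graph n → Set
Connected {n} G = ∀ u v → T (reach n (edges G) u v)

record Subgraph {n : ℕ} (G : Graph n) : Set where
  field
    verts  : Fin n → Bool
    chosen : Fin (length (edges G)) → Bool
    closed : ∀ i → T (chosen i) →
             T (verts (proj₁ (lookup (edges G) i))) × T (verts (proj₂ (lookup (edges G) i)))
open Subgraph public

module _ {n : ℕ} {G : Graph n} where

  degreeIn : Subgraph G → Fin n → ℕ
  degreeIn H v = length (filterᵇ (λ i → chosen H i ∧ incident v (lookup (edges G) i))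
                                 (allFin (length (edges G))))

  MinDegree≥ : ℕ → Subgraph G → Set
  MinDegree≥ k H = ∀ v → T (verts H v) → k ≤ degreeIn H v

  _⊑_ : Subgraph G → Subgraph G → Set
  H ⊑ H' = (∀ v → T (verts H v) → T (verts H' v)) × (∀ i → T (chosen H i) → T (chosen H' i))

  IsCore : ℕ → Subgraph G → Set
  IsCore k H = (∃ λ v → T (verts H v)) × MinDegree≥ k H ×
               (∀ H' → MinDegree≥ k H' → H ⊑ H' → H' ⊑ H)

HasCore : {n : ℕ} → Graph n → ℕ → Set
HasCore G k = Σ (Subgraph G) (IsCore k)

-- The cat never leaves the vertex set S of the k-core.  Call an edge inner if
-- both endpoints lie in S.  While every vertex of S keeps at least j remaining
-- inner edges, the cat (at a vertex of S) can always step along one of them to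
-- another vertex of S, and a cut lowers each vertex's inner degree by at most
-- one; so the game from a vertex of S lasts at least j more cuts, and initially
-- j = k.
module Submission where

open import Defs
open import Data.Nat using (ℕ; zero; suc; _≤_; _<_; z≤n; s≤s)
open import Data.Nat.Properties
  using ( ≤-refl; ≤-trans; ≤-pred; m≤n⇒m≤1+n; m<n⇒0<n; m≤m⊔n; m≤n⊔m; ⊓-glb; suc-injective
        ; module ≤-Reasoning)
open import Data.Fin using (Fin; _≟_)
import Data.Fin.Properties as Fin
open import Data.Bool using (Bool; true; false; _∧_; _∨_; not; if_then_else_; T)
open import Data.Bool.Properties using (T-∧; T-∨; not-involutive)
open import Data.Bool.ListAction using (any)
open import Data.List using (List; []; _∷_; map; length; lookup; allFin; filterᵇ)
open import Data.List.Properties using (map-tabulate; tabulate-lookup)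
open import Data.List.Membership.Propositional using (_∈_; lose)
open import Data.List.Membership.Propositional.Properties
  using (∈-map⁻; ∈-allFin; ∈-lookup; ∈-filter⁺; ∈-filter⁻)
import Data.List.Relation.Unary.All as All
open import Data.List.Relation.Unary.Any using (Any; here; there)
open import Data.List.Relation.Unary.Any.Properties using (any⁺)
open import Data.Product using (_×_; _,_; proj₁; proj₂; Σ-syntax)
open import Data.Sum using (_⊎_; inj₁; inj₂)
import Data.Sum as Sum
open import Function using (id; _∘_)
open import Function.Bundles using (Equivalence)
open import Relation.Nullary using (¬_)
open import Relation.Nullary.Decidable
  using (⌊_⌋; T?; toWitness; fromWitness; toWitnessFalse; fromWitnessFalse)
open import Relation.Binary.PropositionalEquality using (_≡_; refl; sym; trans; cong; subst)

open Equivalence using (to; from)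

length-filterᵇ-map-mono : ∀ {A B : Set} (p : A → Bool) (q : B → Bool) (g : A → B) →
  (∀ x → T (p x) → T (q (g x))) → (xs : List A) →
  length (filterᵇ p xs) ≤ length (filterᵇ q (map g xs))
length-filterᵇ-map-mono p q g p⇒q [] = z≤n
length-filterᵇ-map-mono p q g p⇒q (x ∷ xs) with p x in px | q (g x) in qgx
... | true  | true  = s≤s (length-filterᵇ-map-mono p q g p⇒q xs)
... | false | true  = m≤n⇒m≤1+n (length-filterᵇ-map-mono p q g p⇒q xs)
... | false | false = length-filterᵇ-map-mono p q g p⇒q xs
... | true  | false with () ← subst T qgx (p⇒q x (subst T (sym px) _))

nonempty-filterᵇ : ∀ {A : Set} (p : A → Bool) (xs : List A) →
  0 < length (filterᵇ p xs) → Σ[ x ∈ A ] x ∈ xs × T (p x)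
nonempty-filterᵇ p xs 0<len with filterᵇ p xs in eq
... | x ∷ _ = x , ∈-filter⁻ (T? ∘ p) (subst (x ∈_) (sym eq) (here refl))

map-lookup-allFin : ∀ {A : Set} (xs : List A) → map (lookup xs) (allFin (length xs)) ≡ xs
map-lookup-allFin xs = trans (map-tabulate id (lookup xs)) (tabulate-lookup xs)

length-filterᵇ-∷ : ∀ {A : Set} (p : A → Bool) x (xs : List A) →
  length (filterᵇ p (x ∷ xs)) ≤ suc (length (filterᵇ p xs))
length-filterᵇ-∷ p x xs with p x
... | true  = ≤-refl
... | false = m≤n⇒m≤1+n ≤-refl

length-removals : ∀ {n} (E E' : List (Edge n)) → E' ∈ removals E → length E ≡ suc (length E')
length-removals (e ∷ es) .es (here refl) = refl
length-removals (e ∷ es) E' (there E'∈) with ∈-map⁻ (e ∷_) E'∈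
... | E'' , E''∈ , refl = cong suc (length-removals es E'' E''∈)

length-filterᵇ-removals : ∀ {n} (p : Edge n → Bool) (E E' : List (Edge n)) → E' ∈ removals E →
  length (filterᵇ p E) ≤ suc (length (filterᵇ p E'))
length-filterᵇ-removals p (e ∷ es) .es (here refl) = length-filterᵇ-∷ p e es
length-filterᵇ-removals p (e ∷ es) E' (there E'∈) with ∈-map⁻ (e ∷_) E'∈
... | E'' , E''∈ , refl with p e
...   | true  = s≤s (length-filterᵇ-removals p es E'' E''∈)
...   | false = length-filterᵇ-removals p es E'' E''∈

≤-minL : ∀ {A : Set} (f : A → ℕ) m x (xs : List A) →
  (∀ y → y ∈ x ∷ xs → m ≤ f y) → m ≤ minL (map f (x ∷ xs))
≤-minL f m x []       m≤f = m≤f x (here refl)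
≤-minL f m x (y ∷ xs) m≤f = ⊓-glb (m≤f x (here refl)) (≤-minL f m y xs (λ z z∈ → m≤f z (there z∈)))

≤-maxL : ∀ {A : Set} (f : A → ℕ) (xs : List A) x → x ∈ xs → f x ≤ maxL (map f xs)
≤-maxL f (y ∷ xs) x (here refl) = m≤m⊔n _ _
≤-maxL f (y ∷ xs) x (there x∈)  = ≤-trans (≤-maxL f xs x x∈) (m≤n⊔m (f y) _)

≤-if-false : ∀ {m x y} b → T (not b) → m ≤ y → m ≤ (if b then x else y)
≤-if-false false _ m≤y = m≤y

Adjacent : ∀ {n} → List (Edge n) → Fin n → Fin n → Set
Adjacent E a b = (a , b) ∈ E ⊎ (b , a) ∈ E

≟-refl : ∀ {n} (a : Fin n) → T ⌊ a ≟ a ⌋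
≟-refl a = fromWitness refl

reach-refl : ∀ {n} k (E : List (Edge n)) u → T (reach k E u u)
reach-refl zero    E u = ≟-refl u
reach-refl (suc k) E u = from T-∨ (inj₁ (reach-refl k E u))

reach-adjacent : ∀ {n} k (E : List (Edge n)) {a b} → Adjacent E a b → T (reach (suc k) E a b)
reach-adjacent {n} k E {a} {b} adj = from T-∨ (inj₂ (any⁺ entersAt (viaEdge adj)))
  where
  entersAt : Edge n → Bool
  entersAt e = (⌊ proj₂ e ≟ b ⌋ ∧ reach k E a (proj₁ e)) ∨ (⌊ proj₁ e ≟ b ⌋ ∧ reach k E a (proj₂ e))

  viaEdge : Adjacent E a b → Any (T ∘ entersAt) E
  viaEdge (inj₁ ab∈) = lose ab∈ (from T-∨ (inj₁ (from T-∧ (≟-refl b , reach-refl k E a))))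
  viaEdge (inj₂ ba∈) = lose ba∈ (from T-∨ (inj₂ (from T-∧ (≟-refl b , reach-refl k E a))))

adjacent⇒catMove : ∀ {n} (E : List (Edge n)) {v w} → ¬ w ≡ v → Adjacent E v w → w ∈ catMoves E v
adjacent⇒catMove {suc k} E {v} {w} w≢v adj =
  ∈-filter⁺ (T? ∘ isMove) (∈-allFin w) (from T-∧ (fromWitnessFalse w≢v , reach-adjacent k E adj))
  where
  isMove : Fin (suc k) → Bool
  isMove x = not ⌊ x ≟ v ⌋ ∧ reach (suc k) E v x

incident⁻ : ∀ {n} {v a b : Fin n} → T (incident v (a , b)) → v ≡ a ⊎ v ≡ b
incident⁻ {v = v} {a} {b} v∈e =
  Sum.map (toWitness {a? = v ≟ a}) (toWitness {a? = v ≟ b}) (to T-∨ v∈e)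

incident⇒¬isolated : ∀ {n} {E : List (Edge n)} {v e} →
  e ∈ E → T (incident v e) → T (not (isolated E v))
incident⇒¬isolated {E = E} {v} e∈E v∈e =
  subst T (sym (not-involutive (any (incident v) E))) (any⁺ (incident v) (lose e∈E v∈e))

module _ {n : ℕ} (S : Fin n → Bool) where

  -- Distinctness is built in because the shrinking edge lists of a play no
  -- longer carry the ordering invariant of Graph.
  inner : Edge n → Bool
  inner (a , b) = S a ∧ S b ∧ not ⌊ a ≟ b ⌋

  inner⁻ : ∀ {a b} → T (inner (a , b)) → T (S a) × T (S b) × ¬ a ≡ b
  inner⁻ t with Sa , t′ ← to T-∧ t with Sb , a≢b ← to T-∧ t′ = Sa , Sb , toWitnessFalse a≢b

  inner⁺ : ∀ {a b} → T (S a) → T (S b) → ¬ a ≡ b → T (inner (a , b))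
  inner⁺ Sa Sb a≢b = from T-∧ (Sa , from T-∧ (Sb , fromWitnessFalse a≢b))

  innerDegree : List (Edge n) → Fin n → ℕ
  innerDegree E u = length (filterᵇ (λ e → inner e ∧ incident u e) E)

  MinInnerDegree≥ : ℕ → List (Edge n) → Set
  MinInnerDegree≥ j E = ∀ u → T (S u) → j ≤ innerDegree E u

  minInnerDegree-removals : ∀ {j E E'} → E' ∈ removals E →
    MinInnerDegree≥ (suc j) E → MinInnerDegree≥ j E'
  minInnerDegree-removals {E = E} {E'} E'∈ deg u Su =
    ≤-pred (≤-trans (deg u Su) (length-filterᵇ-removals _ E E' E'∈))

  innerEdgeAt : ∀ E v → 0 < innerDegree E v → Σ[ e ∈ Edge n ] e ∈ E × T (inner e) × T (incident v e)
  innerEdgeAt E v pos with e , e∈E , t ← nonempty-filterᵇ _ E pos = e , e∈E , to T-∧ t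

  innerDegree⇒¬isolated : ∀ E v → 0 < innerDegree E v → T (not (isolated E v))
  innerDegree⇒¬isolated E v pos with _ , e∈E , _ , v∈e ← innerEdgeAt E v pos =
    incident⇒¬isolated {v = v} e∈E v∈e

  innerNeighbour : ∀ E v → 0 < innerDegree E v → Σ[ w ∈ Fin n ] T (S w) × w ∈ catMoves E v
  innerNeighbour E v pos with (a , b) , e∈E , e-inner , v∈e ← innerEdgeAt E v pos
                          with Sa , Sb , a≢b ← inner⁻ e-inner
                          with incident⁻ {v = v} {a} {b} v∈e
  ... | inj₁ refl = b , Sb , adjacent⇒catMove E (a≢b ∘ sym) (inj₁ e∈E)
  ... | inj₂ refl = a , Sa , adjacent⇒catMove E a≢b (inj₂ e∈E)

  mutual
    ≤-herderVal : ∀ j E v → T (S v) → MinInnerDegree≥ j E → j ≤ herderVal (length E) E v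
    ≤-herderVal zero    E        v Sv deg = z≤n
    ≤-herderVal (suc j) []       v Sv deg with () ← deg v Sv
    ≤-herderVal (suc j) E@(e ∷ es) v Sv deg =
      ≤-if-false (isolated E v) (innerDegree⇒¬isolated E v (m<n⇒0<n (deg v Sv)))
        (≤-minL (λ E' → suc (catVal (length es) E' v)) (suc j) es (map (e ∷_) (removals es))
          (λ E' E'∈ → s≤s (afterCut E' E'∈)))
      where
      afterCut : ∀ E' → E' ∈ removals E → j ≤ catVal (length es) E' v
      afterCut E' E'∈ =
        subst (λ f → j ≤ catVal f E' v) (suc-injective (sym (length-removals E E' E'∈)))
          (≤-catVal j E' v Sv (minInnerDegree-removals E'∈ deg))

    ≤-catVal : ∀ j E v → T (S v) → MinInnerDegree≥ j E → j ≤ catVal (length E) E v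
    ≤-catVal zero    E v Sv deg = z≤n
    ≤-catVal (suc j) E v Sv deg =
      let w , Sw , w∈moves = innerNeighbour E v (m<n⇒0<n (deg v Sv)) in
      ≤-if-false (isolated E v) (innerDegree⇒¬isolated E v (m<n⇒0<n (deg v Sv)))
        (≤-trans (≤-herderVal (suc j) E w Sw deg)
                 (≤-maxL (herderVal (length E) E) (catMoves E v) w w∈moves))

degreeIn≤innerDegree : ∀ {n} {G : Graph n} (H : Subgraph G) v →
  degreeIn H v ≤ innerDegree (verts H) (edges G) v
degreeIn≤innerDegree {G = G} H v = begin
  degreeIn H v
    ≤⟨ length-filterᵇ-map-mono _ innerAt (lookup (edges G)) chosen⇒inner (allFin (length (edges G))) ⟩
  length (filterᵇ innerAt (map (lookup (edges G)) (allFin (length (edges G)))))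
    ≡⟨ cong (length ∘ filterᵇ innerAt) (map-lookup-allFin (edges G)) ⟩
  innerDegree (verts H) (edges G) v ∎
  where
  open ≤-Reasoning

  innerAt : Edge _ → Bool
  innerAt e = inner (verts H) e ∧ incident v e

  chosen⇒inner : ∀ i → T (chosen H i ∧ incident v (lookup (edges G) i)) →
                 T (innerAt (lookup (edges G) i))
  chosen⇒inner i t with i-chosen , v∈e ← to T-∧ t with a∈H , b∈H ← closed H i i-chosen =
    from T-∧ (inner⁺ (verts H) a∈H b∈H (Fin.<⇒≢ (All.lookup (ordered G) (∈-lookup i))) , v∈e)

mainTheorem12 : {n : ℕ} (G : Graph n) (k : ℕ) → Connected G → HasCore G k → k ≤ cat G
mainTheorem12 {n} G k _ (H , (v , v∈H) , minDegree , _) = begin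
  k           ≤⟨ ≤-herderVal (verts H) k (edges G) v v∈H coreDegrees ⟩
  catFrom G v ≤⟨ ≤-maxL (catFrom G) (allFin n) v (∈-allFin v) ⟩
  cat G       ∎
  where
  open ≤-Reasoning
  coreDegrees : MinInnerDegree≥ (verts H) k (edges G)
  coreDegrees u u∈H = ≤-trans (minDegree u u∈H) (degreeIn≤innerDegree H u)
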